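{- For $k\ge1$ let $H^{(k)}(z) := \sum_{h\ge0}N_k(h)\,z^h$, where $N_k(h)$ is the number of $(k+1)$-tuples $(\mathfrak{f}',\mathfrak{g}_1,\dots,\mathfrak{g}_k)$ of duplicative forests with $\mathfrak{f}'\in\mathcal{D}^*(\mathfrak{l}_h)$ and $\mathfrak{g}_1,\dots,\mathfrak{g}_k\in\mathcal{D}^*(\mathfrak{f}')$. Then for every $k\ge1$, $$H^{(k)} = 1 + z\,(H^{(k)}\boxtimes H^{(k)}) + z\sum_{i=0}^{k}\binom{k}{i}H^{(k+i)},$$ and the generating series $H_{\mathrm{ns}}(z) := \sum_{h\ge0}I_h\,z^h$, where $I_h$ is the number of intervals of the poset $\mathcal{D}^*(\mathfrak{l}_h)$, satisfies $H_{\mathrm{ns}} = H^{(1)}$.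
   Context: A duplicative forest is a finite word of duplicative trees (empty word $\epsilon$ allowed); a duplicative tree is $\circ(\mathfrak{g})$ or $\bullet(\mathfrak{g})$ for a duplicative forest $\mathfrak{g}$; $\cdot$ is concatenation. $\mathfrak{f}\lessdot\mathfrak{f}'$ iff $\mathfrak{f}'$ is obtained from $\mathfrak{f}$ by replacing one subtree $\circ(\mathfrak{g})$ by $\bullet(\mathfrak{g}\cdot\mathfrak{g})$; $\ll$ is its reflexive transitive closure; $\mathcal{D}^*(\mathfrak{f}) := \{\mathfrak{f}' : \mathfrak{f}\ll\mathfrak{f}'\}$ ordered by $\ll$. Ladders: $\mathfrak{l}_0:=\epsilon$, $\mathfrak{l}_h:=\circ(\mathfrak{l}_{h-1})$. An interval of a poset is a pair $(a,b)$ with $a\le b$. Hadamard product: $(\sum_n a_nz^n)\boxtimes(\sum_n b_nz^n) := \sum_n a_nb_nz^n$. -}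

module Defs where

open import Data.Nat using (ℕ; zero; suc; _+_; _*_)
open import Data.Nat.Combinatorics using (_C_)
open import Data.List using (List; []; _∷_; _++_; length)
open import Data.List.Membership.Propositional using (_∈_)
open import Data.List.Relation.Unary.Unique.Propositional using (Unique)
open import Data.Vec using (Vec)
open import Data.Vec.Relation.Unary.All using (All)
open import Data.Product using (Σ; _×_; _,_)
open import Function.Bundles using (_⇔_)
open import Relation.Binary.PropositionalEquality using (_≡_)
open import Relation.Binary.Construct.Closure.ReflexiveTransitive using (Star)

-- Duplicative trees: ∘(g) = white g, •(g) = black g; forests are finite words (lists) of trees.
data Tree : Set where
  white : List Tree → Tree
  black : List Tree → Tree

Forest : Set
Forest = List Tree

mutual
  data _⋖ᵗ_ : Tree → Tree → Set where
    root    : (g : Forest) → white g ⋖ᵗ black (g ++ g)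
    inWhite : {g g' : Forest} → g ⋖ g' → white g ⋖ᵗ white g'
    inBlack : {g g' : Forest} → g ⋖ g' → black g ⋖ᵗ black g'

  data _⋖_ : Forest → Forest → Set where
    here  : {t t' : Tree} {f : Forest} → t ⋖ᵗ t' → (t ∷ f) ⋖ (t' ∷ f)
    there : {t : Tree} {f f' : Forest} → f ⋖ f' → (t ∷ f) ⋖ (t ∷ f')

_≪_ : Forest → Forest → Set
_≪_ = Star _⋖_

ladder : ℕ → Forest
ladder zero    = []
ladder (suc h) = white (ladder h) ∷ []

HasCount : {A : Set} → (A → Set) → ℕ → Set
HasCount {A} P n = Σ (List A) λ xs → Unique xs × ((x : A) → (x ∈ xs) ⇔ P x) × length xs ≡ n

Tuple : (k h : ℕ) → Forest × Vec Forest k → Set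
Tuple k h (f' , gs) = (ladder h ≪ f') × All (λ g → f' ≪ g) gs

Interval : ℕ → Forest × Forest → Set
Interval h (a , b) = (ladder h ≪ a) × (ladder h ≪ b) × (a ≪ b)

Series : Set
Series = ℕ → ℕ

𝟙 : Series
𝟙 zero    = 1
𝟙 (suc n) = 0

_⊕_ : Series → Series → Series
(a ⊕ b) n = a n + b n

_⊠_ : Series → Series → Series
(a ⊠ b) n = a n * b n

z· : Series → Series
z· a zero    = 0
z· a (suc n) = a n

_·ₛ_ : ℕ → Series → Series
(c ·ₛ a) n = c * a n

sumTo : ℕ → (ℕ → Series) → Series
sumTo zero    F = F 0
sumTo (suc m) F = sumTo m F ⊕ F (suc m)

binomSum : (H : ℕ → Series) → ℕ → Series
binomSum H k = sumTo k (λ i → (k C i) ·ₛ H (k + i))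

-- D*(f) is enumerated explicitly, without repetitions: the descendants of a word are the words
-- of descendants of its letters, those of •(g) are the •(g′) with g′ ∈ D*(g), and those of ∘(g)
-- are the ∘(g′) together with the •(a · b) with a, b ∈ D*(g).  Hence N_k(h) is the sum of
-- |D*(f′)|^k over f′ ∈ D*(l_h), and the number of intervals is N_1(h).  As l_{h+1} = ∘(l_h),
-- the terms of N_k(h+1) are of two kinds: |D*(∘(c))|^k = (d + d²)^k with d = |D*(c)|, which the
-- binomial theorem expands to Σ_i C(k,i) d^{k+i}, and |D*(•(a · b))|^k = |D*(a)|^k |D*(b)|^k,
-- which sum to N_k(h)².

module Submission where

open import Defs
open import Data.Nat using (ℕ; zero; suc; _+_; _*_; _^_; _≤_)
open import Data.Nat.Properties
open import Data.Nat.ListAction using (sum)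
open import Data.Nat.ListAction.Properties using (sum-++)
open import Data.Nat.Combinatorics using (_C_; nCk+nC[k+1]≡[n+1]C[k+1]; k>n⇒nCk≡0)
open import Data.Nat.Tactic.RingSolver using (solve-∀)
open import Data.List using (List; []; _∷_; [_]; _++_; length; map)
open import Data.List.Properties using (∷-injective; length-++; length-map; map-++; map-cong; map-∘)
open import Data.List.Membership.Propositional using (_∈_)
open import Data.List.Membership.Propositional.Properties using (∈-map⁺; ∈-map⁻; ∈-++⁺ˡ; ∈-++⁺ʳ; ∈-++⁻)
open import Data.List.Relation.Unary.Any using (here; there)
import Data.List.Relation.Unary.All as All
open import Data.List.Relation.Unary.AllPairs using ([]; _∷_)
open import Data.List.Relation.Unary.Unique.Propositional using (Unique)
open import Data.List.Relation.Binary.Disjoint.Propositional using (Disjoint)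
open import Data.List.Relation.Unary.Unique.Propositional.Properties using (map⁺; ++⁺)
open import Data.Vec using (Vec; []; _∷_)
import Data.Vec.Properties as Vec
open import Data.Vec.Relation.Unary.All as VecAll using ([]; _∷_)
open import Data.Product using (Σ; ∃₂; _×_; _,_; proj₁; proj₂)
open import Data.Product.Properties using (,-injective)
open import Data.Sum using (_⊎_; inj₁; inj₂)
open import Function using (_∘_; const)
open import Function.Bundles using (_⇔_; mk⇔)
open import Relation.Binary.PropositionalEquality using (_≡_; refl; sym; trans; cong; cong₂; module ≡-Reasoning)
open import Relation.Binary.Construct.Closure.ReflexiveTransitive using (Star; ε; _◅_; _◅◅_; gmap)

open ≡-Reasoning

private variable A B D : Set

-- Finite sums

sum-map-++ : ∀ (φ : A → ℕ) xs ys → sum (map φ (xs ++ ys)) ≡ sum (map φ xs) + sum (map φ ys)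
sum-map-++ φ xs ys = trans (cong sum (map-++ φ xs ys)) (sum-++ (map φ xs) (map φ ys))

sum-map-cong : ∀ {φ ψ : A → ℕ} xs → (∀ x → φ x ≡ ψ x) → sum (map φ xs) ≡ sum (map ψ xs)
sum-map-cong xs eq = cong sum (map-cong eq xs)

sum-map-+ : ∀ (φ ψ : A → ℕ) xs → sum (map (λ x → φ x + ψ x) xs) ≡ sum (map φ xs) + sum (map ψ xs)
sum-map-+ φ ψ []       = refl
sum-map-+ φ ψ (x ∷ xs) = trans (cong (φ x + ψ x +_) (sum-map-+ φ ψ xs)) (+-+-comm (φ x) (ψ x) _ _)
  where
  +-+-comm : ∀ a b c d → a + b + (c + d) ≡ a + c + (b + d)
  +-+-comm = solve-∀

sum-map-*ˡ : ∀ c (φ : A → ℕ) xs → sum (map (λ x → c * φ x) xs) ≡ c * sum (map φ xs)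
sum-map-*ˡ c φ []       = sym (*-zeroʳ c)
sum-map-*ˡ c φ (x ∷ xs) = trans (cong (c * φ x +_) (sum-map-*ˡ c φ xs)) (sym (*-distribˡ-+ c (φ x) _))

sum-map-const : ∀ n (xs : List A) → sum (map (const n) xs) ≡ length xs * n
sum-map-const n []       = refl
sum-map-const n (x ∷ xs) = cong (n +_) (sum-map-const n xs)

sumUpTo : ℕ → (ℕ → ℕ) → ℕ
sumUpTo zero    g = g 0
sumUpTo (suc m) g = sumUpTo m g + g (suc m)

sumTo-apply : ∀ m F n → sumTo m F n ≡ sumUpTo m (λ i → F i n)
sumTo-apply zero    F n = refl
sumTo-apply (suc m) F n = cong (_+ F (suc m) n) (sumTo-apply m F n)

sumUpTo-cong : ∀ m {g g′ : ℕ → ℕ} → (∀ i → g i ≡ g′ i) → sumUpTo m g ≡ sumUpTo m g′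
sumUpTo-cong zero    eq = eq 0
sumUpTo-cong (suc m) eq = cong₂ _+_ (sumUpTo-cong m eq) (eq (suc m))

*-distribˡ-sumUpTo : ∀ c m g → c * sumUpTo m g ≡ sumUpTo m (λ i → c * g i)
*-distribˡ-sumUpTo c zero    g = refl
*-distribˡ-sumUpTo c (suc m) g =
  trans (*-distribˡ-+ c (sumUpTo m g) (g (suc m))) (cong (_+ c * g (suc m)) (*-distribˡ-sumUpTo c m g))

sum-map-sumUpTo : ∀ m (g : ℕ → A → ℕ) xs →
  sum (map (λ x → sumUpTo m (λ i → g i x)) xs) ≡ sumUpTo m (λ i → sum (map (g i) xs))
sum-map-sumUpTo zero    g xs = refl
sum-map-sumUpTo (suc m) g xs =
  trans (sum-map-+ (λ x → sumUpTo m (λ i → g i x)) (g (suc m)) xs)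
        (cong (_+ sum (map (g (suc m)) xs)) (sum-map-sumUpTo m g xs))

-- The binomial theorem

^-distribʳ-* : ∀ m n k → (m * n) ^ k ≡ m ^ k * n ^ k
^-distribʳ-* m n zero    = refl
^-distribʳ-* m n (suc k) = trans (cong (m * n *_) (^-distribʳ-* m n k)) (*-*-comm m n (m ^ k) (n ^ k))
  where
  *-*-comm : ∀ a b c d → a * b * (c * d) ≡ a * c * (b * d)
  *-*-comm = solve-∀

binomialPartialSum : ℕ → ℕ → ℕ → ℕ
binomialPartialSum x k m = sumUpTo m (λ i → (k C i) * x ^ i)

binomialPartialSum-pascal : ∀ x k m →
  binomialPartialSum x (suc k) (suc m) ≡ binomialPartialSum x k (suc m) + x * binomialPartialSum x k m
binomialPartialSum-pascal x k zero = begin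
  1 * 1 + (suc k C 1) * (x * 1)
    ≡⟨ cong (λ c → 1 * 1 + c * (x * 1)) (sym (nCk+nC[k+1]≡[n+1]C[k+1] k 0)) ⟩
  1 * 1 + (1 + (k C 1)) * (x * 1)
    ≡⟨ rearrange (k C 1) x ⟩
  1 * 1 + (k C 1) * (x * 1) + x * (1 * 1) ∎
  where
  rearrange : ∀ c x → 1 * 1 + (1 + c) * (x * 1) ≡ 1 * 1 + c * (x * 1) + x * (1 * 1)
  rearrange = solve-∀
binomialPartialSum-pascal x k (suc m) = begin
  S (suc k) (suc m) + (suc k C suc (suc m)) * x ^ suc (suc m)
    ≡⟨ cong₂ _+_ (binomialPartialSum-pascal x k m)
                 (cong (_* x ^ suc (suc m)) (sym (nCk+nC[k+1]≡[n+1]C[k+1] k (suc m)))) ⟩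
  S k (suc m) + x * S k m + ((k C suc m) + (k C suc (suc m))) * (x * x ^ suc m)
    ≡⟨ rearrange (S k (suc m)) (S k m) (k C suc m) (k C suc (suc m)) x (x ^ suc m) ⟩
  S k (suc m) + (k C suc (suc m)) * x ^ suc (suc m) + x * (S k m + (k C suc m) * x ^ suc m) ∎
  where
  S = binomialPartialSum x
  rearrange : ∀ a b c₁ c₂ x p →
              a + x * b + (c₁ + c₂) * (x * p) ≡ a + c₂ * (x * p) + x * (b + c₁ * p)
  rearrange = solve-∀

binomial-theorem : ∀ x k → (1 + x) ^ k ≡ sumUpTo k (λ i → (k C i) * x ^ i)
binomial-theorem x zero    = refl
binomial-theorem x (suc k) = begin
  (1 + x) * (1 + x) ^ k
    ≡⟨ cong ((1 + x) *_) (binomial-theorem x k) ⟩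
  (1 + x) * S k k
    ≡⟨ rearrange (S k k) x ⟩
  S k k + 0 * x ^ suc k + x * S k k
    ≡⟨ cong (λ c → S k k + c * x ^ suc k + x * S k k) (sym (k>n⇒nCk≡0 (n<1+n k))) ⟩
  S k k + (k C suc k) * x ^ suc k + x * S k k
    ≡⟨ binomialPartialSum-pascal x k k ⟨
  S (suc k) (suc k) ∎
  where
  S = binomialPartialSum x
  rearrange : ∀ s x → (1 + x) * s ≡ s + 0 + x * s
  rearrange = solve-∀

binomial-x+x² : ∀ x k → (x + x * x) ^ k ≡ sumUpTo k (λ i → (k C i) * x ^ (k + i))
binomial-x+x² x k = begin
  (x + x * x) ^ k
    ≡⟨ cong (_^ k) (x+x²≡x*[1+x] x) ⟩
  (x * (1 + x)) ^ k
    ≡⟨ ^-distribʳ-* x (1 + x) k ⟩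
  x ^ k * (1 + x) ^ k
    ≡⟨ cong (x ^ k *_) (binomial-theorem x k) ⟩
  x ^ k * sumUpTo k (λ i → (k C i) * x ^ i)
    ≡⟨ *-distribˡ-sumUpTo (x ^ k) k _ ⟩
  sumUpTo k (λ i → x ^ k * ((k C i) * x ^ i))
    ≡⟨ sumUpTo-cong k (λ i → x*[c*y]≡c*[x*y] (x ^ k) (k C i) (x ^ i)) ⟩
  sumUpTo k (λ i → (k C i) * (x ^ k * x ^ i))
    ≡⟨ sumUpTo-cong k (λ i → cong ((k C i) *_) (^-distribˡ-+-* x k i)) ⟨
  sumUpTo k (λ i → (k C i) * x ^ (k + i)) ∎
  where
  x+x²≡x*[1+x] : ∀ x → x + x * x ≡ x * (1 + x)
  x+x²≡x*[1+x] = solve-∀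
  x*[c*y]≡c*[x*y] : ∀ x c y → x * (c * y) ≡ c * (x * y)
  x*[c*y]≡c*[x*y] = solve-∀

-- Enumerations

productWith : (A → B → D) → List A → (A → List B) → List D
productWith f []       F = []
productWith f (x ∷ xs) F = map (f x) (F x) ++ productWith f xs F

∈-productWith⁺ : ∀ (f : A → B → D) {xs F a b} → a ∈ xs → b ∈ F a → f a b ∈ productWith f xs F
∈-productWith⁺ f {x ∷ xs}     (here refl) b∈ = ∈-++⁺ˡ (∈-map⁺ (f x) b∈)
∈-productWith⁺ f {x ∷ xs} {F} (there a∈)  b∈ = ∈-++⁺ʳ (map (f x) (F x)) (∈-productWith⁺ f a∈ b∈)

∈-productWith⁻ : ∀ (f : A → B → D) xs {F c} → c ∈ productWith f xs F →
                 ∃₂ λ a b → a ∈ xs × b ∈ F a × c ≡ f a b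
∈-productWith⁻ f (x ∷ xs) {F} c∈ with ∈-++⁻ (map (f x) (F x)) c∈
... | inj₁ c∈head with ∈-map⁻ (f x) c∈head
...   | b , b∈ , refl = x , b , here refl , b∈ , refl
∈-productWith⁻ f (x ∷ xs) c∈ | inj₂ c∈tail with ∈-productWith⁻ f xs c∈tail
... | a , b , a∈ , b∈ , refl = a , b , there a∈ , b∈ , refl

InjectiveOn : (A → B → D) → List A → Set
InjectiveOn f xs = ∀ {a a′ b b′} → a ∈ xs → a′ ∈ xs → f a b ≡ f a′ b′ → a ≡ a′ × b ≡ b′

productWith-unique : ∀ (f : A → B → D) {xs F} → InjectiveOn f xs →
                     Unique xs → (∀ a → Unique (F a)) → Unique (productWith f xs F)
productWith-unique f         inj []         uF = []
productWith-unique f {x ∷ xs} {F} inj (x∉ ∷ u) uF =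
  ++⁺ (map⁺ (proj₂ ∘ inj (here refl) (here refl)) (uF x))
      (productWith-unique f (λ p q → inj (there p) (there q)) u uF)
      disjoint
  where
  disjoint : Disjoint (map (f x) (F x)) (productWith f xs F)
  disjoint (c∈head , c∈tail) with ∈-map⁻ (f x) c∈head | ∈-productWith⁻ f xs c∈tail
  ... | _ , _ , refl | a , _ , a∈ , _ , eq = All.lookup x∉ a∈ (proj₁ (inj (here refl) (there a∈) eq))

length-productWith : ∀ (f : A → B → D) xs F → length (productWith f xs F) ≡ sum (map (length ∘ F) xs)
length-productWith f []       F = refl
length-productWith f (x ∷ xs) F =
  trans (length-++ (map (f x) (F x))) (cong₂ _+_ (length-map (f x) (F x)) (length-productWith f xs F))

length-productWith-const : ∀ (f : A → B → D) xs ys →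
                           length (productWith f xs (const ys)) ≡ length xs * length ys
length-productWith-const f xs ys = trans (length-productWith f xs (const ys)) (sum-map-const (length ys) xs)

sum-productWith : ∀ (φ : D → ℕ) (f : A → B → D) xs F →
  sum (map φ (productWith f xs F)) ≡ sum (map (λ a → sum (map (φ ∘ f a) (F a))) xs)
sum-productWith φ f []       F = refl
sum-productWith φ f (x ∷ xs) F = begin
  sum (map φ (map (f x) (F x) ++ productWith f xs F))
    ≡⟨ sum-map-++ φ (map (f x) (F x)) (productWith f xs F) ⟩
  sum (map φ (map (f x) (F x))) + sum (map φ (productWith f xs F))
    ≡⟨ cong₂ _+_ (cong sum (sym (map-∘ (F x)))) (sum-productWith φ f xs F) ⟩
  sum (map (φ ∘ f x) (F x)) + sum (map (λ a → sum (map (φ ∘ f a) (F a))) xs) ∎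

vectorsOver : (k : ℕ) → List A → List (Vec A k)
vectorsOver zero    xs = [ [] ]
vectorsOver (suc k) xs = productWith _∷_ xs (const (vectorsOver k xs))

∈-vectorsOver⁺ : ∀ {k} {xs : List A} {v : Vec A k} → VecAll.All (_∈ xs) v → v ∈ vectorsOver k xs
∈-vectorsOver⁺ []         = here refl
∈-vectorsOver⁺ (x∈ ∷ v∈) = ∈-productWith⁺ _∷_ x∈ (∈-vectorsOver⁺ v∈)

∈-vectorsOver⁻ : ∀ k {xs : List A} {v : Vec A k} → v ∈ vectorsOver k xs → VecAll.All (_∈ xs) v
∈-vectorsOver⁻ zero    {v = []} _ = []
∈-vectorsOver⁻ (suc k) {xs}    v∈ with ∈-productWith⁻ _∷_ xs v∈
... | _ , _ , x∈ , w∈ , refl = x∈ ∷ ∈-vectorsOver⁻ k w∈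

vectorsOver-unique : ∀ k {xs : List A} → Unique xs → Unique (vectorsOver k xs)
vectorsOver-unique zero    u = All.[] ∷ []
vectorsOver-unique (suc k) u =
  productWith-unique _∷_ (λ _ _ → Vec.∷-injective) u (λ _ → vectorsOver-unique k u)

length-vectorsOver : ∀ k (xs : List A) → length (vectorsOver k xs) ≡ length xs ^ k
length-vectorsOver zero    xs = refl
length-vectorsOver (suc k) xs =
  trans (length-productWith-const _∷_ xs (vectorsOver k xs)) (cong (length xs *_) (length-vectorsOver k xs))

-- Descendants

_≪ᵗ_ : Tree → Tree → Set
_≪ᵗ_ = Star _⋖ᵗ_

blackConcat : Forest → Forest → Tree
blackConcat a b = black (a ++ b)

mutual
  descendants : Forest → List Forest
  descendants []      = [ [] ]
  descendants (t ∷ f) = productWith _∷_ (descendantsᵗ t) (const (descendants f))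

  descendantsᵗ : Tree → List Tree
  descendantsᵗ (white g) = map white (descendants g) ++ blackDescendants g
  descendantsᵗ (black g) = map black (descendants g)

  blackDescendants : Forest → List Tree
  blackDescendants g = productWith blackConcat (descendants g) (const (descendants g))

descendantCount : Forest → ℕ
descendantCount f = length (descendants f)

≪-white : ∀ {g g′} → g ≪ g′ → white g ≪ᵗ white g′
≪-white = gmap white inWhite

≪-black : ∀ {g g′} → g ≪ g′ → black g ≪ᵗ black g′
≪-black = gmap black inBlack

≪-head : ∀ {t t′ f} → t ≪ᵗ t′ → (t ∷ f) ≪ (t′ ∷ f)
≪-head {f = f} = gmap (_∷ f) here

≪-tail : ∀ {t f f′} → f ≪ f′ → (t ∷ f) ≪ (t ∷ f′)
≪-tail {t} = gmap (t ∷_) there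

⋖-++ˡ : ∀ {a a′ b} → a ⋖ a′ → (a ++ b) ⋖ (a′ ++ b)
⋖-++ˡ (here s)  = here s
⋖-++ˡ (there s) = there (⋖-++ˡ s)

≪-++ˡ : ∀ {a a′ b} → a ≪ a′ → (a ++ b) ≪ (a′ ++ b)
≪-++ˡ {b = b} = gmap (_++ b) ⋖-++ˡ

≪-++ʳ : ∀ a {b b′} → b ≪ b′ → (a ++ b) ≪ (a ++ b′)
≪-++ʳ []      s = s
≪-++ʳ (t ∷ a) s = ≪-tail (≪-++ʳ a s)

⋖-++⁻ : ∀ a {b c} → (a ++ b) ⋖ c →
        (Σ Forest λ a′ → a ⋖ a′ × c ≡ a′ ++ b) ⊎ (Σ Forest λ b′ → b ⋖ b′ × c ≡ a ++ b′)
⋖-++⁻ []      s         = inj₂ (_ , s , refl)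
⋖-++⁻ (t ∷ a) (here s)  = inj₁ (_ , here s , refl)
⋖-++⁻ (t ∷ a) (there s) with ⋖-++⁻ a s
... | inj₁ (a′ , s′ , refl) = inj₁ (t ∷ a′ , there s′ , refl)
... | inj₂ (b′ , s′ , refl) = inj₂ (b′ , s′ , refl)

mutual
  descendants-sound : ∀ f {x} → x ∈ descendants f → f ≪ x
  descendants-sound []      (here refl) = ε
  descendants-sound (t ∷ f) x∈ with ∈-productWith⁻ _∷_ (descendantsᵗ t) x∈
  ... | _ , _ , t′∈ , f′∈ , refl = ≪-head (descendantsᵗ-sound t t′∈) ◅◅ ≪-tail (descendants-sound f f′∈)

  descendantsᵗ-sound : ∀ t {x} → x ∈ descendantsᵗ t → t ≪ᵗ x
  descendantsᵗ-sound (white g) x∈ with ∈-++⁻ (map white (descendants g)) x∈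
  ... | inj₁ x∈whites with ∈-map⁻ white x∈whites
  ...   | _ , g′∈ , refl = ≪-white (descendants-sound g g′∈)
  descendantsᵗ-sound (white g) x∈ | inj₂ x∈blacks with ∈-productWith⁻ blackConcat (descendants g) x∈blacks
  ... | a , _ , a∈ , b∈ , refl =
    root g ◅ ≪-black (≪-++ˡ (descendants-sound g a∈) ◅◅ ≪-++ʳ a (descendants-sound g b∈))
  descendantsᵗ-sound (black g) x∈ with ∈-map⁻ black x∈
  ... | _ , g′∈ , refl = ≪-black (descendants-sound g g′∈)

mutual
  descendants-refl : ∀ f → f ∈ descendants f
  descendants-refl []      = here refl
  descendants-refl (t ∷ f) = ∈-productWith⁺ _∷_ (descendantsᵗ-refl t) (descendants-refl f)

  descendantsᵗ-refl : ∀ t → t ∈ descendantsᵗ t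
  descendantsᵗ-refl (white g) = ∈-++⁺ˡ (∈-map⁺ white (descendants-refl g))
  descendantsᵗ-refl (black g) = ∈-map⁺ black (descendants-refl g)

mutual
  descendants-step : ∀ f {x y} → x ∈ descendants f → x ⋖ y → y ∈ descendants f
  descendants-step []      (here refl) ()
  descendants-step (t ∷ f) x∈ s with ∈-productWith⁻ _∷_ (descendantsᵗ t) x∈
  ... | _ , _ , t′∈ , f′∈ , refl with s
  ...   | here s′  = ∈-productWith⁺ _∷_ (descendantsᵗ-step t t′∈ s′) f′∈
  ...   | there s′ = ∈-productWith⁺ _∷_ t′∈ (descendants-step f f′∈ s′)

  descendantsᵗ-step : ∀ t {x y} → x ∈ descendantsᵗ t → x ⋖ᵗ y → y ∈ descendantsᵗ t
  descendantsᵗ-step (white g) x∈ s with ∈-++⁻ (map white (descendants g)) x∈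
  ... | inj₁ x∈whites with ∈-map⁻ white x∈whites
  ...   | _ , g′∈ , refl with s
  ...     | root _     = ∈-++⁺ʳ (map white (descendants g)) (∈-productWith⁺ blackConcat g′∈ g′∈)
  ...     | inWhite s′ = ∈-++⁺ˡ (∈-map⁺ white (descendants-step g g′∈ s′))
  descendantsᵗ-step (white g) x∈ s | inj₂ x∈blacks with ∈-productWith⁻ blackConcat (descendants g) x∈blacks
  ... | a , _ , a∈ , b∈ , refl with s
  ...   | inBlack s′ with ⋖-++⁻ a s′
  ...     | inj₁ (_ , s″ , refl) =
    ∈-++⁺ʳ (map white (descendants g)) (∈-productWith⁺ blackConcat (descendants-step g a∈ s″) b∈)
  ...     | inj₂ (_ , s″ , refl) =
    ∈-++⁺ʳ (map white (descendants g)) (∈-productWith⁺ blackConcat a∈ (descendants-step g b∈ s″))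
  descendantsᵗ-step (black g) x∈ s with ∈-map⁻ black x∈
  ... | _ , g′∈ , refl with s
  ...   | inBlack s′ = ∈-map⁺ black (descendants-step g g′∈ s′)

descendants-complete : ∀ f {x} → f ≪ x → x ∈ descendants f
descendants-complete f = go (descendants-refl f)
  where
  go : ∀ {y x} → y ∈ descendants f → y ≪ x → x ∈ descendants f
  go y∈ ε       = y∈
  go y∈ (s ◅ r) = go (descendants-step f y∈ s) r

length-descendant : ∀ f {x} → x ∈ descendants f → length x ≡ length f
length-descendant []      (here refl) = refl
length-descendant (t ∷ f) x∈ with ∈-productWith⁻ _∷_ (descendantsᵗ t) x∈
... | _ , _ , _ , f′∈ , refl = cong suc (length-descendant f f′∈)

++-injective : ∀ (a a′ : List A) {b b′} → length a ≡ length a′ → a ++ b ≡ a′ ++ b′ → a ≡ a′ × b ≡ b′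
++-injective []      []        _  eq = refl , eq
++-injective (x ∷ a) (x′ ∷ a′) ∣a∣≡∣a′∣ eq with ∷-injective eq
... | refl , eq′ with ++-injective a a′ (suc-injective ∣a∣≡∣a′∣) eq′
...   | refl , refl = refl , refl

white-injective : ∀ {g g′} → white g ≡ white g′ → g ≡ g′
white-injective refl = refl

black-injective : ∀ {g g′} → black g ≡ black g′ → g ≡ g′
black-injective refl = refl

mutual
  descendants-unique : ∀ f → Unique (descendants f)
  descendants-unique []      = All.[] ∷ []
  descendants-unique (t ∷ f) =
    productWith-unique _∷_ (λ _ _ → ∷-injective) (descendantsᵗ-unique t) (λ _ → descendants-unique f)

  descendantsᵗ-unique : ∀ t → Unique (descendantsᵗ t)
  descendantsᵗ-unique (white g) =
    ++⁺ (map⁺ white-injective (descendants-unique g))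
        (productWith-unique blackConcat blackConcat-injective
                            (descendants-unique g) (λ _ → descendants-unique g))
        white≢blackConcat
    where
    -- a and b are recovered from a ++ b since all descendants of g have the length of g.
    blackConcat-injective : InjectiveOn blackConcat (descendants g)
    blackConcat-injective {a} {a′} a∈ a′∈ eq =
      ++-injective a a′ (trans (length-descendant g a∈) (sym (length-descendant g a′∈)))
                        (black-injective eq)
    white≢blackConcat : Disjoint (map white (descendants g)) (blackDescendants g)
    white≢blackConcat (x∈whites , x∈blacks)
      with ∈-map⁻ white x∈whites | ∈-productWith⁻ blackConcat (descendants g) x∈blacks
    ... | _ , _ , refl | _ , _ , _ , _ , ()
  descendantsᵗ-unique (black g) = map⁺ black-injective (descendants-unique g)

tupleCount : ℕ → Forest → ℕ
tupleCount k f = sum (map (λ c → descendantCount c ^ k) (descendants f))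

DescendantTuple : (k : ℕ) → Forest → Forest × Vec Forest k → Set
DescendantTuple k f (f′ , gs) = (f ≪ f′) × VecAll.All (f′ ≪_) gs

descendantTuples : (k : ℕ) → Forest → List (Forest × Vec Forest k)
descendantTuples k f = productWith _,_ (descendants f) (λ c → vectorsOver k (descendants c))

descendantTuples-count : ∀ k f → HasCount (DescendantTuple k f) (tupleCount k f)
descendantTuples-count k f = descendantTuples k f , unique , membership , count
  where
  unique : Unique (descendantTuples k f)
  unique = productWith-unique _,_ (λ _ _ → ,-injective) (descendants-unique f)
                              (λ c → vectorsOver-unique k (descendants-unique c))
  membership : ∀ x → x ∈ descendantTuples k f ⇔ DescendantTuple k f x
  membership (f′ , gs) = mk⇔ to from
    where
    to : (f′ , gs) ∈ descendantTuples k f → DescendantTuple k f (f′ , gs)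
    to x∈ with ∈-productWith⁻ _,_ (descendants f) x∈
    ... | _ , _ , f′∈ , gs∈ , refl =
      descendants-sound f f′∈ , VecAll.map (descendants-sound f′) (∈-vectorsOver⁻ k gs∈)
    from : DescendantTuple k f (f′ , gs) → (f′ , gs) ∈ descendantTuples k f
    from (f≪f′ , f′≪gs) = ∈-productWith⁺ _,_ (descendants-complete f f≪f′)
                                             (∈-vectorsOver⁺ (VecAll.map (descendants-complete f′) f′≪gs))
  count : length (descendantTuples k f) ≡ tupleCount k f
  count = trans (length-productWith _,_ (descendants f) _)
                (sum-map-cong (descendants f) (λ c → length-vectorsOver k (descendants c)))

IntervalAbove : Forest → Forest × Forest → Set
IntervalAbove f (a , b) = (f ≪ a) × (f ≪ b) × (a ≪ b)

intervalsAbove : Forest → List (Forest × Forest)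
intervalsAbove f = productWith _,_ (descendants f) descendants

intervalsAbove-count : ∀ f → HasCount (IntervalAbove f) (tupleCount 1 f)
intervalsAbove-count f = intervalsAbove f , unique , membership , count
  where
  unique : Unique (intervalsAbove f)
  unique = productWith-unique _,_ (λ _ _ → ,-injective) (descendants-unique f) descendants-unique
  membership : ∀ x → x ∈ intervalsAbove f ⇔ IntervalAbove f x
  membership (a , b) = mk⇔ to from
    where
    to : (a , b) ∈ intervalsAbove f → IntervalAbove f (a , b)
    to x∈ with ∈-productWith⁻ _,_ (descendants f) x∈
    ... | _ , _ , a∈ , b∈ , refl =
      descendants-sound f a∈ , descendants-sound f a∈ ◅◅ descendants-sound a b∈ , descendants-sound a b∈
    from : IntervalAbove f (a , b) → (a , b) ∈ intervalsAbove f
    from (f≪a , _ , a≪b) = ∈-productWith⁺ _,_ (descendants-complete f f≪a) (descendants-complete a a≪b)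
  count : length (intervalsAbove f) ≡ tupleCount 1 f
  count = trans (length-productWith _,_ (descendants f) descendants)
                (sum-map-cong (descendants f) (λ c → sym (*-identityʳ _)))

descendantCountᵗ : Tree → ℕ
descendantCountᵗ t = length (descendantsᵗ t)

descendantCount-∷ : ∀ t f → descendantCount (t ∷ f) ≡ descendantCountᵗ t * descendantCount f
descendantCount-∷ t f = length-productWith-const _∷_ (descendantsᵗ t) (descendants f)

descendantCount-++ : ∀ a b → descendantCount (a ++ b) ≡ descendantCount a * descendantCount b
descendantCount-++ []      b = sym (+-identityʳ _)
descendantCount-++ (t ∷ a) b = begin
  descendantCount (t ∷ a ++ b)
    ≡⟨ descendantCount-∷ t (a ++ b) ⟩
  descendantCountᵗ t * descendantCount (a ++ b)
    ≡⟨ cong (descendantCountᵗ t *_) (descendantCount-++ a b) ⟩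
  descendantCountᵗ t * (descendantCount a * descendantCount b)
    ≡⟨ *-assoc (descendantCountᵗ t) _ _ ⟨
  descendantCountᵗ t * descendantCount a * descendantCount b
    ≡⟨ cong (_* descendantCount b) (descendantCount-∷ t a) ⟨
  descendantCount (t ∷ a) * descendantCount b ∎

descendantCount-singleton : ∀ t → descendantCount [ t ] ≡ descendantCountᵗ t
descendantCount-singleton t = trans (descendantCount-∷ t []) (*-identityʳ _)

descendantCountᵗ-white : ∀ g →
  descendantCountᵗ (white g) ≡ descendantCount g + descendantCount g * descendantCount g
descendantCountᵗ-white g =
  trans (length-++ (map white (descendants g)))
        (cong₂ _+_ (length-map white (descendants g))
                   (length-productWith-const blackConcat (descendants g) (descendants g)))

descendantCountᵗ-blackConcat : ∀ a b →
  descendantCountᵗ (blackConcat a b) ≡ descendantCount a * descendantCount b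
descendantCountᵗ-blackConcat a b = trans (length-map black (descendants (a ++ b))) (descendantCount-++ a b)

sum-descendants-singleton : ∀ (φ : Forest → ℕ) t →
  sum (map φ (descendants [ t ])) ≡ sum (map (φ ∘ [_]) (descendantsᵗ t))
sum-descendants-singleton φ t =
  trans (sum-productWith φ _∷_ (descendantsᵗ t) (const [ [] ]))
        (sum-map-cong (descendantsᵗ t) (λ _ → +-identityʳ _))

tupleCount-white : ∀ k g → tupleCount k [ white g ] ≡
  tupleCount k g * tupleCount k g + sumUpTo k (λ i → (k C i) * tupleCount (k + i) g)
tupleCount-white k g = begin
  tupleCount k [ white g ]
    ≡⟨ sum-descendants-singleton φ (white g) ⟩
  sum (map (φ ∘ [_]) (descendantsᵗ (white g)))
    ≡⟨ sum-map-cong (descendantsᵗ (white g)) (cong (_^ k) ∘ descendantCount-singleton) ⟩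
  sum (map ψ (map white ds ++ blacks))
    ≡⟨ sum-map-++ ψ (map white ds) blacks ⟩
  sum (map ψ (map white ds)) + sum (map ψ blacks)
    ≡⟨ +-comm (sum (map ψ (map white ds))) _ ⟩
  sum (map ψ blacks) + sum (map ψ (map white ds))
    ≡⟨ cong₂ _+_ sum-blacks sum-whites ⟩
  T * T + sumUpTo k (λ i → (k C i) * tupleCount (k + i) g) ∎
  where
  ds = descendants g
  blacks = blackDescendants g
  T = tupleCount k g
  φ : Forest → ℕ
  φ c = descendantCount c ^ k
  ψ : Tree → ℕ
  ψ t = descendantCountᵗ t ^ k
  sum-whites : sum (map ψ (map white ds)) ≡ sumUpTo k (λ i → (k C i) * tupleCount (k + i) g)
  sum-whites = begin
    sum (map ψ (map white ds))
      ≡⟨ cong sum (map-∘ ds) ⟨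
    sum (map (λ c → descendantCountᵗ (white c) ^ k) ds)
      ≡⟨ sum-map-cong ds (λ c → trans (cong (_^ k) (descendantCountᵗ-white c))
                                      (binomial-x+x² (descendantCount c) k)) ⟩
    sum (map (λ c → sumUpTo k (λ i → (k C i) * descendantCount c ^ (k + i))) ds)
      ≡⟨ sum-map-sumUpTo k (λ i c → (k C i) * descendantCount c ^ (k + i)) ds ⟩
    sumUpTo k (λ i → sum (map (λ c → (k C i) * descendantCount c ^ (k + i)) ds))
      ≡⟨ sumUpTo-cong k (λ i → sum-map-*ˡ (k C i) (λ c → descendantCount c ^ (k + i)) ds) ⟩
    sumUpTo k (λ i → (k C i) * tupleCount (k + i) g) ∎
  sum-blacks : sum (map ψ blacks) ≡ T * T
  sum-blacks = begin
    sum (map ψ blacks)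
      ≡⟨ sum-productWith ψ blackConcat ds (const ds) ⟩
    sum (map (λ a → sum (map (ψ ∘ blackConcat a) ds)) ds)
      ≡⟨ sum-map-cong ds (λ a → sum-map-cong ds (λ b →
           trans (cong (_^ k) (descendantCountᵗ-blackConcat a b))
                 (^-distribʳ-* (descendantCount a) (descendantCount b) k))) ⟩
    sum (map (λ a → sum (map (λ b → φ a * φ b) ds)) ds)
      ≡⟨ sum-map-cong ds (λ a → trans (sum-map-*ˡ (φ a) φ ds) (*-comm (φ a) T)) ⟩
    sum (map (λ a → T * φ a) ds)
      ≡⟨ sum-map-*ˡ T φ ds ⟩
    T * T ∎

ladderSeries : ℕ → Series
ladderSeries k h = tupleCount k (ladder h)

ladderSeries-recurrence : ∀ k n →
  ladderSeries k n ≡ (𝟙 ⊕ (z· (ladderSeries k ⊠ ladderSeries k) ⊕ z· (binomSum ladderSeries k))) n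
ladderSeries-recurrence k zero    = trans (+-identityʳ _) (^-zeroˡ k)
ladderSeries-recurrence k (suc n) =
  trans (tupleCount-white k (ladder n))
        (cong (ladderSeries k n * ladderSeries k n +_) (sym (sumTo-apply k _ n)))

proposition3p4p10 :
    Σ (ℕ → Series) λ H →
      ((k : ℕ) → 1 ≤ k → (h : ℕ) → HasCount (Tuple k h) (H k h))
      × ((k : ℕ) → 1 ≤ k → (n : ℕ) →
           H k n ≡ (𝟙 ⊕ (z· (H k ⊠ H k) ⊕ z· (binomSum H k))) n)
      × ((h : ℕ) → HasCount (Interval h) (H 1 h))
proposition3p4p10 =
    ladderSeries
  , (λ k _ h → descendantTuples-count k (ladder h))
  , (λ k _ → ladderSeries-recurrence k)
  , (λ h → intervalsAbove-count (ladder h))
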